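{- For every $n\ge2$ there is a bijection $\psi:\mathcal{T}_n\cap\mathcal{F}\to\mathcal{T}_{n-1}$ such that for all $s\in\mathcal{T}_n\cap\mathcal{F}$: $\mathsf{max}(\psi(s))=\mathsf{max}(s)-1$, $\mathsf{rep}(\psi(s))=\mathsf{rep}(s)$ and $\mathsf{mpair}(\psi(s))=\mathsf{mpair}(s)$.
   Context: An inversion sequence of length $n$ is $s=(s_1,\dots,s_n)$ with $0\le s_i<i$. $\mathsf{rep}(s)=n-|\{s_1,\dots,s_n\}|$; $\mathsf{max}(s)=|\{i:s_i=i-1\}|$; positions $i$ with $s_i=i-1$ are called maximals. $\mathcal{T}_n$ is the set of inversion sequences of length $n$ with no $i<j$ such that $s_i=s_j+1$; $\mathcal{T}$ is the union over $n$. For $s\in\mathcal{T}_n\setminus\{(0,1,\dots,n-1)\}$, index the maximals from left to right starting at $0$, the $i$-th maximal at position $k_i$, and let $\mathsf{mpair}(s)=\max\{0\le i\le\mathsf{max}(s)-1:s_{k_i+1}=s_{k_i}\}$; set $\mathsf{mpair}(0,1,\dots,n-1)=0$. $\mathcal{F}$ is the set of $s\in\mathcal{T}$ with $\mathsf{mpair}(s)<\mathsf{max}(s)-1$ such that the $(\mathsf{mpair}(s)+1)$-th maximal is either the last entry of $s$ or is immediately followed by a maximal. -}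

module Defs where

open import Data.Nat using (ℕ; zero; suc; _≤_; _<_; _∸_; _⊔_; _≟_)
open import Data.Bool using (Bool; true; false; if_then_else_)
open import Data.List using (List; []; _∷_; length; filter; deduplicate; upTo)
open import Data.Maybe using (Maybe; just; nothing)
open import Data.Product using (Σ; ∃; _×_; _,_)
open import Data.Sum using (_⊎_)
open import Data.Empty using (⊥)
open import Relation.Binary.PropositionalEquality using (_≡_)
open import Relation.Nullary.Decidable using (⌊_⌋)

-- Sequences are lists of naturals; positions are 0-based, so the paper's
-- entry s_i (1-based) is  at s (i - 1).

at : List ℕ → ℕ → Maybe ℕ
at []       _       = nothing
at (x ∷ xs) zero    = just x
at (x ∷ xs) (suc j) = at xs j

-- inversion sequence: s_i < i (1-based), i.e. entry at 0-based j is ≤ j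
IsInvSeq : List ℕ → Set
IsInvSeq s = ∀ j x → at s j ≡ just x → x ≤ j

Avoids : List ℕ → Set
Avoids s = ∀ i j x → i < j → at s i ≡ just (suc x) → at s j ≡ just x → ⊥

InT : ℕ → List ℕ → Set
InT n s = length s ≡ n × IsInvSeq s × Avoids s

T : ℕ → Set
T n = Σ (List ℕ) (InT n)

rep : List ℕ → ℕ
rep s = length s ∸ length (deduplicate _≟_ s)

isMaximalAt : List ℕ → ℕ → Bool
isMaximalAt s k with at s k
... | just x  = ⌊ x ≟ k ⌋
... | nothing = false

-- 0-based positions of the maximals (s_i = i - 1 in 1-based terms), increasing
maxPositions : List ℕ → List ℕ
maxPositions s = filter (λ k → isMaximalAt s k Data.Bool.≟ true) (upTo (length s))

maxStat : List ℕ → ℕ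
maxStat s = length (maxPositions s)

pairAfter : List ℕ → ℕ → Bool
pairAfter s k with at s k | at s (suc k)
... | just x | just y = ⌊ x ≟ y ⌋
... | _      | _      = false

mpairGo : List ℕ → ℕ → List ℕ → ℕ
mpairGo s i []       = 0
mpairGo s i (k ∷ ks) = (if pairAfter s k then i else 0) ⊔ mpairGo s (suc i) ks

-- mpair(s); for the identity sequence no index qualifies and the value is 0
mpair : List ℕ → ℕ
mpair s = mpairGo s 0 (maxPositions s)

-- membership in ℱ: mpair(s) < max(s) - 1 and the (mpair(s)+1)-th maximal,
-- at 0-based position k, is the last entry or is followed by a maximal
InF : List ℕ → Set
InF s = suc (mpair s) < maxStat s
      × ∃ λ k → at (maxPositions s) (suc (mpair s)) ≡ just k
              × (suc k ≡ length s ⊎ at s (suc k) ≡ just (suc k))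

TF : ℕ → Set
TF n = Σ (List ℕ) (λ s → InT n s × InF s)

module Submission where

-- Write s = A ++ k ∷ B, where k = length A is the (mpair s + 1)-th maximal.  ψ deletes this entry
-- and lowers every later entry above k by one.  Membership in ℱ says that B is empty or starts
-- with k + 1, and together with the avoided pattern this keeps k out of B; hence ψ is undone by
-- reinserting k at the (mpair + 1)-th maximal of ψ(s), or at the end if there is none, and
-- raising the later entries that are at least k.  Entries below k are untouched and the others
-- move injectively, so one entry and one distinct value disappear and rep is preserved.  The
-- maximals after position k move one step left and keep their pair status, and by the definition
-- of mpair neither they nor the deleted maximal are paired; so max drops by one and mpair is
-- unchanged.

open import Defs
open import Data.Nat using (ℕ; zero; suc; _+_; _∸_; _≤_; _<_; _⊔_; z≤n; s≤s; _≟_)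
open import Data.Nat.Properties
open import Data.Bool using (Bool; true; false; if_then_else_)
import Data.Bool as Bool
open import Data.List using (List; []; _∷_; _++_; length; map; filter; applyUpTo; take; drop; deduplicate)
open import Data.List.Properties using (length-++; length-map; map-++; map-∘; map-id; map-id-local; map-cong; ++-identityʳ)
open import Data.List.Membership.Propositional using (_∈_; _∉_)
open import Data.List.Membership.Propositional.Properties using (∈-++⁻; ∈-map⁻; deduplicate-∈⇔)
open import Data.List.Membership.Propositional.Properties.WithK using (unique∧set⇒bag)
open import Data.List.Relation.Unary.All as All using (All; []; _∷_)
import Data.List.Relation.Unary.All.Properties as Allₚ
open import Data.List.Relation.Unary.Any using (here; there)
open import Data.List.Relation.Unary.AllPairs using (AllPairs; []; _∷_)
import Data.List.Relation.Unary.AllPairs.Properties as AllPairsₚ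
open import Data.List.Relation.Unary.Unique.Propositional using (Unique)
import Data.List.Relation.Unary.Unique.Propositional.Properties as Uniqueₚ
open import Data.List.Relation.Unary.Unique.DecPropositional.Properties _≟_ using (deduplicate-!)
open import Data.List.Relation.Binary.BagAndSetEquality as Bag using (_∼[_]_; set; bag-=⇒; ↭⇒∼bag; ∼bag⇒↭)
open import Data.List.Relation.Binary.Permutation.Propositional.Properties using (↭-length; shift)
open import Data.Maybe using (Maybe; just; nothing; fromMaybe) renaming (map to mapMaybe)
open import Data.Maybe.Properties using (just-injective)
open import Data.Product using (Σ; ∃; ∃₂; _×_; _,_; proj₁; proj₂)
open import Data.Sum using (_⊎_; inj₁; inj₂; [_,_]′)
open import Data.Empty using (⊥-elim)
open import Function using (_∘_; _⇔_; mk⇔; Equivalence)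
import Function.Properties.Equivalence as ⇔
open import Relation.Nullary.Decidable using (Dec; ⌊_⌋; does-⇔; isYes≗does; dec-false; yes; no)
open import Relation.Binary.PropositionalEquality
open ≡-Reasoning

-- Lowering and raising values

lower : ℕ → ℕ → ℕ
lower zero    zero    = zero
lower zero    (suc x) = x
lower (suc k) zero    = zero
lower (suc k) (suc x) = suc (lower k x)

raise : ℕ → ℕ → ℕ
raise zero    x       = suc x
raise (suc k) zero    = zero
raise (suc k) (suc x) = suc (raise k x)

lower-fixes-≤ : ∀ {k x} → x ≤ k → lower k x ≡ x
lower-fixes-≤ {zero}  z≤n       = refl
lower-fixes-≤ {suc k} z≤n       = refl
lower-fixes-≤ {suc k} (s≤s x≤k) = cong suc (lower-fixes-≤ x≤k)

lower-suc-≥ : ∀ {k x} → k ≤ x → lower k (suc x) ≡ x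
lower-suc-≥ {zero}          z≤n       = refl
lower-suc-≥ {suc k} {suc x} (s≤s k≤x) = cong suc (lower-suc-≥ k≤x)

lower-<⇒fixed : ∀ {k} x → lower k x < k → lower k x ≡ x
lower-<⇒fixed {suc k} zero    _               = refl
lower-<⇒fixed {suc k} (suc x) (s≤s lower<k) = cong suc (lower-<⇒fixed x lower<k)

raise-≥ : ∀ {k x} → k ≤ x → raise k x ≡ suc x
raise-≥ {zero}  z≤n       = refl
raise-≥ {suc k} (s≤s k≤x) = cong suc (raise-≥ k≤x)

lower-raise : ∀ k x → lower k (raise k x) ≡ x
lower-raise zero    x       = refl
lower-raise (suc k) zero    = refl
lower-raise (suc k) (suc x) = cong suc (lower-raise k x)

raise-lower : ∀ {k x} → x ≢ k → raise k (lower k x) ≡ x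
raise-lower {zero}  {zero}  x≢k = ⊥-elim (x≢k refl)
raise-lower {zero}  {suc x} x≢k = refl
raise-lower {suc k} {zero}  x≢k = refl
raise-lower {suc k} {suc x} x≢k = cong suc (raise-lower (x≢k ∘ cong suc))

raise-≢ : ∀ k x → raise k x ≢ k
raise-≢ (suc k) (suc x) e = raise-≢ k x (suc-injective e)

raise-injective : ∀ k {x y} → raise k x ≡ raise k y → x ≡ y
raise-injective k {x} {y} e = trans (sym (lower-raise k x)) (trans (cong (lower k) e) (lower-raise k y))

lower-injective : ∀ {k x y} → x ≢ k → y ≢ k → lower k x ≡ lower k y → x ≡ y
lower-injective x≢k y≢k e = trans (sym (raise-lower x≢k)) (trans (cong (raise _) e) (raise-lower y≢k))

lower-suc : ∀ {k x} → x ≢ k → suc x ≢ k → lower k (suc x) ≡ suc (lower k x)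
lower-suc {zero}  {zero}  x≢k _    = ⊥-elim (x≢k refl)
lower-suc {zero}  {suc x} _   _    = refl
lower-suc {suc k} {zero}  _   _    = cong suc (lower-fixes-≤ {k} z≤n)
lower-suc {suc k} {suc x} x≢k sx≢k = cong suc (lower-suc (x≢k ∘ cong suc) (sx≢k ∘ cong suc))

≤-suc⇒lower-≤ : ∀ {k m x} → k ≤ m → x ≤ suc m → lower k x ≤ m
≤-suc⇒lower-≤ {zero}          {x = zero}  _         _         = z≤n
≤-suc⇒lower-≤ {zero}          {x = suc x} _         (s≤s x≤m) = x≤m
≤-suc⇒lower-≤ {suc k}         {x = zero}  _         _         = z≤n
≤-suc⇒lower-≤ {suc k} {suc m} {suc x}     (s≤s k≤m) (s≤s x≤m) = s≤s (≤-suc⇒lower-≤ k≤m x≤m)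

lower-≤⇒≤-suc : ∀ {k m} x → lower k x ≤ m → x ≤ suc m
lower-≤⇒≤-suc             zero    _        = z≤n
lower-≤⇒≤-suc {zero}      (suc x) x≤m      = s≤s x≤m
lower-≤⇒≤-suc {suc k} {suc m} (suc x) (s≤s ≤m) = s≤s (lower-≤⇒≤-suc {k} x ≤m)

raise-< : ∀ {k x} → x < k → raise k x ≡ x
raise-< {suc k} {zero}  _         = refl
raise-< {suc k} {suc x} (s≤s x<k) = cong suc (raise-< x<k)

at-++ˡ : ∀ xs {ys} {j} → j < length xs → at (xs ++ ys) j ≡ at xs j
at-++ˡ (x ∷ xs) {j = zero}  _         = refl
at-++ˡ (x ∷ xs) {j = suc j} (s≤s j<n) = at-++ˡ xs j<n

at-++-length : ∀ xs {ys} → at (xs ++ ys) (length xs) ≡ at ys 0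
at-++-length []       = refl
at-++-length (x ∷ xs) = at-++-length xs

at-map : ∀ (f : ℕ → ℕ) xs j → at (map f xs) j ≡ mapMaybe f (at xs j)
at-map f []       j       = refl
at-map f (x ∷ xs) zero    = refl
at-map f (x ∷ xs) (suc j) = at-map f xs j

at⇒∈ : ∀ xs {j x} → at xs j ≡ just x → x ∈ xs
at⇒∈ (y ∷ xs) {zero}  refl = here refl
at⇒∈ (y ∷ xs) {suc j} e    = there (at⇒∈ xs e)

∈⇒at : ∀ {xs : List ℕ} {x} → x ∈ xs → ∃ λ j → at xs j ≡ just x
∈⇒at (here refl) = 0 , refl
∈⇒at (there x∈xs) with ∈⇒at x∈xs
... | j , e = suc j , e

at⇒< : ∀ xs {j x} → at xs j ≡ just x → j < length xs
at⇒< (y ∷ xs) {zero}  _ = s≤s z≤n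
at⇒< (y ∷ xs) {suc j} e = s≤s (at⇒< xs e)

at-nothing⇒≤ : ∀ (xs : List ℕ) {j} → at xs j ≡ nothing → length xs ≤ j
at-nothing⇒≤ []       _ = z≤n
at-nothing⇒≤ (x ∷ xs) {suc j} e = s≤s (at-nothing⇒≤ xs e)

at-split : ∀ xs {j x} → at xs j ≡ just x → ∃₂ λ A B → length A ≡ j × xs ≡ A ++ x ∷ B
at-split (y ∷ xs) {zero}  refl = [] , xs , refl , refl
at-split (y ∷ xs) {suc j} e with at-split xs e
... | A , B , refl , refl = y ∷ A , B , refl , refl

index-of-∷ : ∀ xs {x ys j} → x ∉ xs → x ∉ ys → at (xs ++ x ∷ ys) j ≡ just x → j ≡ length xs
index-of-∷ []       {j = zero}  _    _    _ = refl
index-of-∷ []       {j = suc j} _    x∉ys e = ⊥-elim (x∉ys (at⇒∈ _ e))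
index-of-∷ (y ∷ xs) {j = zero}  x∉xs _    refl = ⊥-elim (x∉xs (here refl))
index-of-∷ (y ∷ xs) {j = suc j} x∉xs x∉ys e = cong suc (index-of-∷ xs (x∉xs ∘ there) x∉ys e)

at-++-∷-suc : ∀ xs {y ys} → at (xs ++ y ∷ ys) (suc (length xs)) ≡ at ys 0
at-++-∷-suc []       = refl
at-++-∷-suc (x ∷ xs) = at-++-∷-suc xs

take-++ : ∀ xs {ys : List ℕ} → take (length xs) (xs ++ ys) ≡ xs
take-++ []       = refl
take-++ (x ∷ xs) = cong (x ∷_) (take-++ xs)

drop-++ : ∀ xs {ys : List ℕ} → drop (length xs) (xs ++ ys) ≡ ys
drop-++ []       = refl
drop-++ (x ∷ xs) = drop-++ xs

drop-++-∷ : ∀ xs {y} {ys : List ℕ} → drop (suc (length xs)) (xs ++ y ∷ ys) ≡ ys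
drop-++-∷ []       = refl
drop-++-∷ (x ∷ xs) = drop-++-∷ xs

∉-< : ∀ {x xs} → All (_< x) xs → x ∉ xs
∉-< (y<x ∷ _)   (here refl)  = <-irrefl refl y<x
∉-< (_   ∷ ys<) (there x∈xs) = ∉-< ys< x∈xs

∉-> : ∀ {x xs} → All (x <_) xs → x ∉ xs
∉-> (x<y ∷ _)   (here refl)  = <-irrefl refl x<y
∉-> (_   ∷ x<ys) (there x∈xs) = ∉-> x<ys x∈xs

∉⇒All≢ : ∀ {x : ℕ} {xs} → x ∉ xs → All (_≢ x) xs
∉⇒All≢ {xs = xs} x∉xs = All.tabulate (λ y∈xs y≡x → x∉xs (subst (_∈ xs) y≡x y∈xs))

length-deduplicate : ∀ {xs ys : List ℕ} → Unique ys → xs ∼[ set ] ys → length (deduplicate _≟_ xs) ≡ length ys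
length-deduplicate {xs} ys! xs≈ys =
  ↭-length (∼bag⇒↭ (unique∧set⇒bag (deduplicate-! xs) ys! (⇔.trans (⇔.sym (deduplicate-∈⇔ _≟_)) xs≈ys)))

length-deduplicate-map : ∀ {f : ℕ → ℕ} → (∀ {x y} → f x ≡ f y → x ≡ y) → ∀ xs →
  length (deduplicate _≟_ (map f xs)) ≡ length (deduplicate _≟_ xs)
length-deduplicate-map {f} f-inj xs = trans
  (length-deduplicate (Uniqueₚ.map⁺ f-inj (deduplicate-! xs)) (Bag.map-cong (λ _ → refl) (deduplicate-∈⇔ _≟_)))
  (length-map f (deduplicate _≟_ xs))

length-deduplicate-insert : ∀ xs {x ys} → x ∉ xs ++ ys →
  length (deduplicate _≟_ (xs ++ x ∷ ys)) ≡ suc (length (deduplicate _≟_ (xs ++ ys)))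
length-deduplicate-insert xs {x} {ys} x∉ = length-deduplicate
  (Allₚ.¬Any⇒All¬ _ (x∉ ∘ Equivalence.from (deduplicate-∈⇔ _≟_)) ∷ deduplicate-! (xs ++ ys))
  (⇔.trans (bag-=⇒ (↭⇒∼bag (shift x xs ys))) (Bag.∷-cong refl (deduplicate-∈⇔ _≟_)))

-- Inversion sequences and pattern avoidance

data InvSeqFrom (i : ℕ) : List ℕ → Set where
  []  : InvSeqFrom i []
  _∷_ : ∀ {x xs} → x ≤ i → InvSeqFrom (suc i) xs → InvSeqFrom i (x ∷ xs)

invSeqFrom⇔ : ∀ i xs → (∀ j x → at xs j ≡ just x → x ≤ i + j) ⇔ InvSeqFrom i xs
invSeqFrom⇔ i xs = mk⇔ (to i xs) (from i xs)
  where
  to : ∀ i xs → (∀ j x → at xs j ≡ just x → x ≤ i + j) → InvSeqFrom i xs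
  to i []       _ = []
  to i (x ∷ xs) h = subst (x ≤_) (+-identityʳ i) (h 0 x refl)
                  ∷ to (suc i) xs (λ j y e → subst (y ≤_) (+-suc i j) (h (suc j) y e))
  from : ∀ i xs → InvSeqFrom i xs → ∀ j x → at xs j ≡ just x → x ≤ i + j
  from i (y ∷ xs) (y≤i ∷ _)  zero    x refl = ≤-trans y≤i (m≤m+n i 0)
  from i (y ∷ xs) (_   ∷ ys) (suc j) x e    = subst (x ≤_) (sym (+-suc i j)) (from (suc i) xs ys j x e)

IsInvSeq⇔InvSeqFrom : ∀ s → IsInvSeq s ⇔ InvSeqFrom 0 s
IsInvSeq⇔InvSeqFrom = invSeqFrom⇔ 0

invSeqFrom-++⁺ : ∀ {i} xs {ys} → InvSeqFrom i xs → InvSeqFrom (i + length xs) ys → InvSeqFrom i (xs ++ ys)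
invSeqFrom-++⁺ {i} []       {ys} []          ys! = subst (λ j → InvSeqFrom j ys) (+-identityʳ i) ys!
invSeqFrom-++⁺ {i} (x ∷ xs) {ys} (x≤i ∷ xs!) ys! =
  x≤i ∷ invSeqFrom-++⁺ xs xs! (subst (λ j → InvSeqFrom j ys) (+-suc i (length xs)) ys!)

invSeqFrom-++⁻ : ∀ {i} xs {ys} → InvSeqFrom i (xs ++ ys) → InvSeqFrom i xs × InvSeqFrom (i + length xs) ys
invSeqFrom-++⁻ {i} []       {ys} ys!          = [] , subst (λ j → InvSeqFrom j ys) (sym (+-identityʳ i)) ys!
invSeqFrom-++⁻ {i} (x ∷ xs) {ys} (x≤i ∷ xys!) with invSeqFrom-++⁻ xs xys!
... | xs! , ys! = x≤i ∷ xs! , subst (λ j → InvSeqFrom j ys) (sym (+-suc i (length xs))) ys!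

invSeqFrom⇒< : ∀ {i xs} → InvSeqFrom i xs → All (_< i + length xs) xs
invSeqFrom⇒< []                     = []
invSeqFrom⇒< {i} {x ∷ xs} (x≤i ∷ xs!) =
  ≤-<-trans x≤i (m<m+n i (s≤s z≤n)) ∷ All.map (λ {y} → subst (y <_) (sym (+-suc i (length xs)))) (invSeqFrom⇒< xs!)

invSeqFrom-lower⁺ : ∀ {k i} → k ≤ i → ∀ {xs} → InvSeqFrom (suc i) xs → InvSeqFrom i (map (lower k) xs)
invSeqFrom-lower⁺         k≤i []         = []
invSeqFrom-lower⁺ {i = i} k≤i (x≤ ∷ xs!) =
  ≤-suc⇒lower-≤ k≤i x≤ ∷ invSeqFrom-lower⁺ (≤-trans k≤i (n≤1+n i)) xs!

invSeqFrom-lower⁻ : ∀ {k i} xs → InvSeqFrom i (map (lower k) xs) → InvSeqFrom (suc i) xs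
invSeqFrom-lower⁻         []       []         = []
invSeqFrom-lower⁻ {k = k} (x ∷ xs) (x≤ ∷ xs!) = lower-≤⇒≤-suc {k} x x≤ ∷ invSeqFrom-lower⁻ {k} xs xs!

_≢1+_ : ℕ → ℕ → Set
a ≢1+ b = a ≢ suc b

Avoids⇔AllPairs : ∀ s → Avoids s ⇔ AllPairs _≢1+_ s
Avoids⇔AllPairs s = mk⇔ (to s) (from s)
  where
  to : ∀ s → Avoids s → AllPairs _≢1+_ s
  to []       _  = []
  to (x ∷ xs) av = All.tabulate head ∷ to xs (λ i j y i<j → av (suc i) (suc j) y (s≤s i<j))
    where
    head : ∀ {y} → y ∈ xs → x ≢1+ y
    head {y} y∈xs x≡1+y with ∈⇒at y∈xs
    ... | j , e = av 0 (suc j) y (s≤s z≤n) (cong just x≡1+y) e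
  from : ∀ s → AllPairs _≢1+_ s → Avoids s
  from (x ∷ xs) (x≢ ∷ _)   zero    (suc j) y _         ei ej = All.lookup x≢ (at⇒∈ xs ej) (just-injective ei)
  from (x ∷ xs) (_  ∷ xs!) (suc i) (suc j) y (s≤s i<j) ei ej = from xs xs! i j y i<j ei ej

allPairs-++⁻ : ∀ {R : ℕ → ℕ → Set} xs {ys} → AllPairs R (xs ++ ys) →
  AllPairs R xs × All (λ x → All (R x) ys) xs × AllPairs R ys
allPairs-++⁻ []       ys!            = [] , [] , ys!
allPairs-++⁻ (x ∷ xs) (x~xys ∷ xys!) with allPairs-++⁻ xs xys! | Allₚ.++⁻ xs x~xys
... | xs! , xs~ys , ys! | x~xs , x~ys = x~xs ∷ xs! , x~ys ∷ xs~ys , ys!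

allPairs-mapWith : ∀ {P : ℕ → Set} {R S : ℕ → ℕ → Set} → (∀ {x y} → P x → P y → R x y → S x y) →
  ∀ {xs} → All P xs → AllPairs R xs → AllPairs S xs
allPairs-mapWith f []         []          = []
allPairs-mapWith f (px ∷ pxs) (x~xs ∷ xs!) = All.zipWith (λ (py , r) → f px py r) (pxs , x~xs) ∷ allPairs-mapWith f pxs xs!

≢1+-lower : ∀ {k a b} → a ≤ k → a ≢1+ b → a ≢1+ lower k b
≢1+-lower {k} {a} {b} a≤k a≢1+b a≡1+lower = a≢1+b (trans a≡1+lower (cong suc (lower-<⇒fixed b lower<k)))
  where
  lower<k : lower k b < k
  lower<k = subst (_≤ k) a≡1+lower a≤k

≢1+-unlower : ∀ {k a b} → a ≤ k → a ≢1+ lower k b → a ≢1+ b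
≢1+-unlower {k} a≤k a≢1+lower a≡1+b =
  a≢1+lower (trans a≡1+b (cong suc (sym (lower-fixes-≤ (≤-trans (n≤1+n _) (subst (_≤ k) a≡1+b a≤k))))))

lower-≢1+ : ∀ {k x y} → x ≢ k → y ≢ k → k ≢1+ y → x ≢1+ y → lower k x ≢1+ lower k y
lower-≢1+ x≢k y≢k k≢1+y x≢1+y e =
  x≢1+y (lower-injective x≢k (k≢1+y ∘ sym) (trans e (sym (lower-suc y≢k (k≢1+y ∘ sym)))))

lower-≢1+⁻ : ∀ {k x y} → x ≢ k → y ≢ k → lower k x ≢1+ lower k y → x ≢1+ y
lower-≢1+⁻ x≢k y≢k lower≢ refl = lower≢ (lower-suc y≢k x≢k)

-- Maximals and pairs

maxFrom : ℕ → List ℕ → List ℕ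
maxFrom i []       = []
maxFrom i (x ∷ xs) = if ⌊ x ≟ i ⌋ then i ∷ maxFrom (suc i) xs else maxFrom (suc i) xs

filter-≟true-∷ : ∀ (b : ℕ → Bool) y ys → let P? = λ j → b j Bool.≟ true in
  filter P? (y ∷ ys) ≡ (if b y then y ∷ filter P? ys else filter P? ys)
filter-≟true-∷ b y ys with b y
... | true  = refl
... | false = refl

isMaximalAt-just : ∀ s {j x} → at s j ≡ just x → isMaximalAt s j ≡ ⌊ x ≟ j ⌋
isMaximalAt-just s e rewrite e = refl

maxPositions-from : ∀ s xs i (f : ℕ → ℕ) → (∀ d → f d ≡ i + d) → (∀ d → at s (i + d) ≡ at xs d) →
  filter (λ j → isMaximalAt s j Bool.≟ true) (applyUpTo f (length xs)) ≡ maxFrom i xs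
maxPositions-from s []       i f f≡ at≡ = refl
maxPositions-from s (x ∷ xs) i f f≡ at≡ = begin
  filter P? (f 0 ∷ applyUpTo (f ∘ suc) (length xs))
    ≡⟨ filter-≟true-∷ (isMaximalAt s) (f 0) _ ⟩
  (if isMaximalAt s (f 0) then f 0 ∷ rest else rest)
    ≡⟨ cong₂ (λ b j → if b then j ∷ rest else rest)
             (trans (cong (isMaximalAt s) f0≡i) (isMaximalAt-just s s[i]≡x)) f0≡i ⟩
  (if ⌊ x ≟ i ⌋ then i ∷ rest else rest)
    ≡⟨ cong (λ r → if ⌊ x ≟ i ⌋ then i ∷ r else r) IH ⟩
  maxFrom i (x ∷ xs) ∎
  where
  P? = λ j → isMaximalAt s j Bool.≟ true
  rest = filter P? (applyUpTo (f ∘ suc) (length xs))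
  f0≡i : f 0 ≡ i
  f0≡i = trans (f≡ 0) (+-identityʳ i)
  s[i]≡x : at s i ≡ just x
  s[i]≡x = trans (cong (at s) (sym (+-identityʳ i))) (at≡ 0)
  IH : rest ≡ maxFrom (suc i) xs
  IH = maxPositions-from s xs (suc i) (f ∘ suc) (λ d → trans (f≡ (suc d)) (+-suc i d))
                         (λ d → trans (cong (at s) (sym (+-suc i d))) (at≡ (suc d)))

maxPositions≡maxFrom : ∀ s → maxPositions s ≡ maxFrom 0 s
maxPositions≡maxFrom s = maxPositions-from s s 0 (λ j → j) (λ _ → refl) (λ _ → refl)

maxFrom-++ : ∀ i xs {ys} → maxFrom i (xs ++ ys) ≡ maxFrom i xs ++ maxFrom (i + length xs) ys
maxFrom-++ i []       {ys} = cong (λ j → maxFrom j ys) (sym (+-identityʳ i))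
maxFrom-++ i (x ∷ xs) {ys}
  with ⌊ x ≟ i ⌋ | trans (maxFrom-++ (suc i) xs) (cong (λ j → maxFrom (suc i) xs ++ maxFrom j ys) (sym (+-suc i (length xs))))
... | true  | IH = cong (i ∷_) IH
... | false | IH = IH

maxFrom-self : ∀ i xs → maxFrom i (i ∷ xs) ≡ i ∷ maxFrom (suc i) xs
maxFrom-self i xs rewrite ≟-diag (refl {x = i}) = refl

lower≡⇔ : ∀ {k i x} → k ≤ i → x ≢ k → lower k x ≡ i ⇔ x ≡ suc i
lower≡⇔ {k} {i} {x} k≤i x≢k = mk⇔
  (λ lower≡i → trans (sym (raise-lower x≢k)) (trans (cong (raise k) lower≡i) (raise-≥ k≤i)))
  (λ x≡1+i → trans (cong (lower k) x≡1+i) (lower-suc-≥ k≤i))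

maxFrom-lower : ∀ {k i} → k ≤ i → ∀ xs → k ∉ xs → maxFrom (suc i) xs ≡ map suc (maxFrom i (map (lower k) xs))
maxFrom-lower         k≤i []       _   = refl
maxFrom-lower {k} {i} k≤i (x ∷ xs) k∉
  with x ≟ suc i | lower k x ≟ i | maxFrom-lower (≤-trans k≤i (n≤1+n i)) xs (k∉ ∘ there)
... | yes _     | yes _    | IH = cong (suc i ∷_) IH
... | no _      | no _     | IH = IH
... | yes x≡1+i | no ≢i    | _  = ⊥-elim (≢i (Equivalence.from (lower≡⇔ k≤i (k∉ ∘ here ∘ sym)) x≡1+i))
... | no ≢1+i   | yes ≡i   | _  = ⊥-elim (≢1+i (Equivalence.to (lower≡⇔ k≤i (k∉ ∘ here ∘ sym)) ≡i))

maxFrom-sound : ∀ i xs → All (λ j → ∃ λ d → j ≡ i + d × at xs d ≡ just j) (maxFrom i xs)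
maxFrom-sound i []       = []
maxFrom-sound i (x ∷ xs)
  with x ≟ i | All.map (λ { (d , refl , e) → suc d , sym (+-suc i d) , e }) (maxFrom-sound (suc i) xs)
... | yes refl | later = (0 , sym (+-identityʳ i) , refl) ∷ later
... | no _     | later = later

maxFrom-≥ : ∀ i xs → All (i ≤_) (maxFrom i xs)
maxFrom-≥ i xs = All.map (λ { (d , refl , _) → m≤m+n i d }) (maxFrom-sound i xs)

maxFrom-< : ∀ i xs → All (_< i + length xs) (maxFrom i xs)
maxFrom-< i xs = All.map (λ { (d , refl , e) → +-monoʳ-< i (at⇒< xs e) }) (maxFrom-sound i xs)

maxFrom-maximal : ∀ xs → All (λ j → at xs j ≡ just j) (maxFrom 0 xs)
maxFrom-maximal xs = All.map (λ { (d , refl , e) → e }) (maxFrom-sound 0 xs)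

maxPositions-maximal : ∀ s {q j} → at (maxPositions s) q ≡ just j → at s j ≡ just j
maxPositions-maximal s {q} {j} e =
  All.lookup (maxFrom-maximal s) (at⇒∈ _ (subst (λ L → at L q ≡ just j) (maxPositions≡maxFrom s) e))


isYes-⇔ : ∀ {A B : Set} → A ⇔ B → (a? : Dec A) (b? : Dec B) → ⌊ a? ⌋ ≡ ⌊ b? ⌋
isYes-⇔ A⇔B a? b? = trans (isYes≗does a?) (trans (does-⇔ A⇔B a? b?) (sym (isYes≗does b?)))

pairTest : Maybe ℕ → Maybe ℕ → Bool
pairTest (just x) (just y) = ⌊ x ≟ y ⌋
pairTest _        _        = false

pairTest-≢ : ∀ {x y} → x ≢ y → pairTest (just x) (just y) ≡ false
pairTest-≢ {x} {y} x≢y = trans (isYes≗does (x ≟ y)) (dec-false (x ≟ y) x≢y)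

pairAfter≡pairTest : ∀ s j → pairAfter s j ≡ pairTest (at s j) (at s (suc j))
pairAfter≡pairTest s j with at s j | at s (suc j)
... | just _  | just _  = refl
... | just _  | nothing = refl
... | nothing | _       = refl

pairAfter-∷ : ∀ x xs j → pairAfter (x ∷ xs) (suc j) ≡ pairAfter xs j
pairAfter-∷ x xs j = trans (pairAfter≡pairTest (x ∷ xs) (suc j)) (sym (pairAfter≡pairTest xs j))

pairAfter-++ʳ : ∀ xs {ys} j → pairAfter (xs ++ ys) (length xs + j) ≡ pairAfter ys j
pairAfter-++ʳ []       j = refl
pairAfter-++ʳ (x ∷ xs) j = trans (pairAfter-∷ x (xs ++ _) (length xs + j)) (pairAfter-++ʳ xs j)

pairAfter-map : ∀ {f : ℕ → ℕ} xs → (∀ {x y} → x ∈ xs → y ∈ xs → f x ≡ f y → x ≡ y) →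
  ∀ j → pairAfter (map f xs) j ≡ pairAfter xs j
pairAfter-map {f} xs f-inj j = begin
  pairAfter (map f xs) j
    ≡⟨ pairAfter≡pairTest (map f xs) j ⟩
  pairTest (at (map f xs) j) (at (map f xs) (suc j))
    ≡⟨ cong₂ pairTest (at-map f xs j) (at-map f xs (suc j)) ⟩
  pairTest (mapMaybe f (at xs j)) (mapMaybe f (at xs (suc j)))
    ≡⟨ pairTest-map (at xs j) (at xs (suc j)) refl refl ⟩
  pairTest (at xs j) (at xs (suc j))
    ≡⟨ sym (pairAfter≡pairTest xs j) ⟩
  pairAfter xs j ∎
  where
  pairTest-map : ∀ m n → at xs j ≡ m → at xs (suc j) ≡ n → pairTest (mapMaybe f m) (mapMaybe f n) ≡ pairTest m n
  pairTest-map (just x) (just y) ex ey =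
    isYes-⇔ (mk⇔ (f-inj (at⇒∈ xs ex) (at⇒∈ xs ey)) (cong f)) (f x ≟ f y) (x ≟ y)
  pairTest-map (just x) nothing  _  _  = refl
  pairTest-map nothing  _        _  _  = refl

mpairGo-++ : ∀ s i L {M} → mpairGo s i (L ++ M) ≡ mpairGo s i L ⊔ mpairGo s (i + length L) M
mpairGo-++ s i []      {M} = cong (λ j → mpairGo s j M) (sym (+-identityʳ i))
mpairGo-++ s i (x ∷ L) {M} = begin
  h ⊔ mpairGo s (suc i) (L ++ M)
    ≡⟨ cong (h ⊔_) (mpairGo-++ s (suc i) L) ⟩
  h ⊔ (mpairGo s (suc i) L ⊔ mpairGo s (suc i + length L) M)
    ≡⟨ sym (⊔-assoc h _ _) ⟩
  (h ⊔ mpairGo s (suc i) L) ⊔ mpairGo s (suc i + length L) M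
    ≡⟨ cong (λ j → (h ⊔ mpairGo s (suc i) L) ⊔ mpairGo s j M) (sym (+-suc i (length L))) ⟩
  (h ⊔ mpairGo s (suc i) L) ⊔ mpairGo s (i + suc (length L)) M ∎
  where h = if pairAfter s x then i else 0

mpairGo-map : ∀ {s t} (f : ℕ → ℕ) i {L} → All (λ j → pairAfter s (f j) ≡ pairAfter t j) L →
  mpairGo s i (map f L) ≡ mpairGo t i L
mpairGo-map f i []      = refl
mpairGo-map f i (e ∷ es) = cong₂ (λ b m → (if b then i else 0) ⊔ m) e (mpairGo-map f (suc i) es)

mpairGo-vanishes : ∀ s i L → mpairGo s i L < i → ∀ j → mpairGo s j L ≡ 0
mpairGo-vanishes s i []      _ j = refl
mpairGo-vanishes s i (x ∷ L) m<i j with pairAfter s x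
... | true  = ⊥-elim (<-irrefl refl (≤-<-trans (m≤m⊔n i _) m<i))
... | false = mpairGo-vanishes s (suc i) L (m<n⇒m<1+n m<i) (suc j)

mpairGo-< : ∀ s i L {b} → 0 < b → i + length L ≤ b → mpairGo s i L < b
mpairGo-< s i []      0<b _      = 0<b
mpairGo-< s i (x ∷ L) {b} 0<b i+n≤b = ⊔-lub (head (pairAfter s x)) (mpairGo-< s (suc i) L 0<b 1+i+n≤b)
  where
  1+i+n≤b : suc i + length L ≤ b
  1+i+n≤b = subst (_≤ b) (+-suc i (length L)) i+n≤b
  head : ∀ p → (if p then i else 0) < b
  head true  = ≤-trans (s≤s (m≤m+n i (length L))) 1+i+n≤b
  head false = 0<b

-- Deleting and inserting the selected maximal

deleteMaximal : ℕ → List ℕ → List ℕ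
deleteMaximal k s = take k s ++ map (lower k) (drop (suc k) s)

insertMaximal : ℕ → List ℕ → List ℕ
insertMaximal k t = take k t ++ k ∷ map (raise k) (drop k t)

-- If s has no (mpair s + 1)-th maximal, the default length s puts a reinserted maximal at the end.
selected : List ℕ → ℕ
selected s = fromMaybe (length s) (at (maxPositions s) (suc (mpair s)))

deleteSelected : List ℕ → List ℕ
deleteSelected s = deleteMaximal (selected s) s

insertSelected : List ℕ → List ℕ
insertSelected t = insertMaximal (selected t) t

record IsDeletion (n : ℕ) (s t : List ℕ) : Set where
  field
    inT      : InT (n ∸ 1) t
    maxStat≡ : maxStat t ≡ maxStat s ∸ 1
    rep≡     : rep t ≡ rep s
    mpair≡   : mpair t ≡ mpair s
    inverse  : insertSelected t ≡ s

invSeq-prefix-< : ∀ xs {ys} → IsInvSeq (xs ++ ys) → All (_< length xs) xs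
invSeq-prefix-< xs s-inv = invSeqFrom⇒< (proj₁ (invSeqFrom-++⁻ xs (Equivalence.to (IsInvSeq⇔InvSeqFrom _) s-inv)))

data NextIsMaximal (k : ℕ) : List ℕ → Set where
  last : NextIsMaximal k []
  next : ∀ B → NextIsMaximal k (suc k ∷ B)

map-raise-lower : ∀ {k B} → k ∉ B → map (raise k) (map (lower k) B) ≡ B
map-raise-lower k∉B = trans (sym (map-∘ _)) (map-id-local (All.map raise-lower (∉⇒All≢ k∉B)))

map-lower-raise : ∀ k xs → map (lower k) (map (raise k) xs) ≡ xs
map-lower-raise k xs = trans (sym (map-∘ xs)) (trans (map-cong (lower-raise k) xs) (map-id xs))

-- withMaximal B has the maximal k at position k = length A; when this is its selected maximal,
-- withoutMaximal B is its image under ψ.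
module Prefix (A : List ℕ) where

  k : ℕ
  k = length A

  withMaximal : List ℕ → List ℕ
  withMaximal B = A ++ k ∷ B

  withoutMaximal : List ℕ → List ℕ
  withoutMaximal B = A ++ map (lower k) B

  deleteMaximal-withMaximal : ∀ B → deleteMaximal k (withMaximal B) ≡ withoutMaximal B
  deleteMaximal-withMaximal B = cong₂ (λ xs ys → xs ++ map (lower k) ys) (take-++ A) (drop-++-∷ A)

  insertMaximal-withoutMaximal : ∀ {B} → k ∉ B → insertMaximal k (withoutMaximal B) ≡ withMaximal B
  insertMaximal-withoutMaximal k∉B = trans
    (cong₂ (λ xs ys → xs ++ k ∷ map (raise k) ys) (take-++ A) (drop-++ A))
    (cong (λ ys → A ++ k ∷ ys) (map-raise-lower k∉B))

  length-withMaximal : ∀ B → length (withMaximal B) ≡ suc (length (withoutMaximal B))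
  length-withMaximal B = begin
    length (A ++ k ∷ B)                 ≡⟨ length-++ A ⟩
    k + suc (length B)                  ≡⟨ +-suc k (length B) ⟩
    suc (k + length B)                  ≡⟨ cong (λ n → suc (k + n)) (sym (length-map (lower k) B)) ⟩
    suc (k + length (map (lower k) B))  ≡⟨ cong suc (sym (length-++ A)) ⟩
    suc (length (withoutMaximal B))     ∎

  invSeq-delete : ∀ {B} → IsInvSeq (withMaximal B) → IsInvSeq (withoutMaximal B)
  invSeq-delete {B} s-inv with invSeqFrom-++⁻ A (Equivalence.to (IsInvSeq⇔InvSeqFrom _) s-inv)
  ... | A-inv , _ ∷ B-inv =
    Equivalence.from (IsInvSeq⇔InvSeqFrom _) (invSeqFrom-++⁺ A A-inv (invSeqFrom-lower⁺ ≤-refl B-inv))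

  invSeq-insert : ∀ {B} → IsInvSeq (withoutMaximal B) → IsInvSeq (withMaximal B)
  invSeq-insert {B} t-inv with invSeqFrom-++⁻ A (Equivalence.to (IsInvSeq⇔InvSeqFrom _) t-inv)
  ... | A-inv , B-inv =
    Equivalence.from (IsInvSeq⇔InvSeqFrom _) (invSeqFrom-++⁺ A A-inv (≤-refl ∷ invSeqFrom-lower⁻ {k} B B-inv))

  avoids-delete : ∀ {B} → All (_< k) A → k ∉ B → Avoids (withMaximal B) → Avoids (withoutMaximal B)
  avoids-delete {B} A<k k∉B s-av with allPairs-++⁻ A (Equivalence.to (Avoids⇔AllPairs _) s-av)
  ... | A! , A~kB , k~B ∷ B! = Equivalence.from (Avoids⇔AllPairs _)
    (AllPairsₚ.++⁺ A! (AllPairsₚ.map⁺ (allPairs-mapWith lower-pair (All.zip (∉⇒All≢ k∉B , k~B)) B!)) A~B)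
    where
    lower-pair : ∀ {x y} → x ≢ k × k ≢1+ x → y ≢ k × k ≢1+ y → x ≢1+ y → lower k x ≢1+ lower k y
    lower-pair (x≢k , _) (y≢k , k≢1+y) = lower-≢1+ x≢k y≢k k≢1+y
    A~B : All (λ a → All (a ≢1+_) (map (lower k) B)) A
    A~B = All.zipWith (λ (a<k , a~kB) → Allₚ.map⁺ (All.map (≢1+-lower (<⇒≤ a<k)) (All.tail a~kB))) (A<k , A~kB)

  avoids-insert : ∀ {B} → All (_< k) A → k ∉ B → NextIsMaximal k B → Avoids (withoutMaximal B) → Avoids (withMaximal B)
  avoids-insert {B} A<k k∉B nxt t-av with allPairs-++⁻ A (Equivalence.to (Avoids⇔AllPairs _) t-av)
  ... | A! , A~B , B! = Equivalence.from (Avoids⇔AllPairs _)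
    (AllPairsₚ.++⁺ A! (k~B nxt B! ∷ allPairs-mapWith lower-≢1+⁻ (∉⇒All≢ k∉B) (AllPairsₚ.map⁻ B!)) A~kB)
    where
    A~kB : All (λ a → All (a ≢1+_) (k ∷ B)) A
    A~kB = All.zipWith (λ (a<k , a~B) → (λ a≡1+k → <-asym (n<1+n k) (subst (_< k) a≡1+k a<k))
                                          ∷ All.map (≢1+-unlower (<⇒≤ a<k)) (Allₚ.map⁻ a~B))
                       (A<k , A~B)
    k~B : ∀ {B′} → NextIsMaximal k B′ → AllPairs _≢1+_ (map (lower k) B′) → All (k ≢1+_) B′
    k~B last      _            = []
    k~B (next B0) (k′~B0′ ∷ _) =
      <⇒≢ (m<n⇒m<1+n (n<1+n k))
      ∷ All.map (≢1+-unlower ≤-refl)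
                (Allₚ.map⁻ (subst (λ y → All (y ≢1+_) (map (lower k) B0)) (lower-suc-≥ ≤-refl) k′~B0′))

  avoids⇒∉ : ∀ {B} → NextIsMaximal k B → Avoids (withMaximal B) → k ∉ B
  avoids⇒∉ last      _    ()
  avoids⇒∉ (next B0) s-av with allPairs-++⁻ A (Equivalence.to (Avoids⇔AllPairs _) s-av)
  ... | _ , _ , _ ∷ 1+k~B0 ∷ _ = λ
    { (here k≡1+k)  → 1+n≢n (sym k≡1+k)
    ; (there k∈B0) → All.lookup 1+k~B0 k∈B0 refl }

  P : List ℕ
  P = maxFrom 0 A

  c : ℕ
  c = length P

  X : List ℕ → List ℕ
  X B = maxFrom k (map (lower k) B)

  P<k : All (_< k) P
  P<k = maxFrom-< 0 A

  maxPositions-withMaximal : ∀ {B} → k ∉ B → maxPositions (withMaximal B) ≡ P ++ k ∷ map suc (X B)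
  maxPositions-withMaximal {B} k∉B = begin
    maxPositions (A ++ k ∷ B)     ≡⟨ maxPositions≡maxFrom (A ++ k ∷ B) ⟩
    maxFrom 0 (A ++ k ∷ B)        ≡⟨ maxFrom-++ 0 A ⟩
    P ++ maxFrom k (k ∷ B)        ≡⟨ cong (P ++_) (maxFrom-self k B) ⟩
    P ++ k ∷ maxFrom (suc k) B    ≡⟨ cong (λ L → P ++ k ∷ L) (maxFrom-lower ≤-refl B k∉B) ⟩
    P ++ k ∷ map suc (X B)        ∎

  maxPositions-withoutMaximal : ∀ B → maxPositions (withoutMaximal B) ≡ P ++ X B
  maxPositions-withoutMaximal B = trans (maxPositions≡maxFrom (withoutMaximal B)) (maxFrom-++ 0 A)

  maxStat-delete : ∀ {B} → k ∉ B → maxStat (withoutMaximal B) ≡ maxStat (withMaximal B) ∸ 1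
  maxStat-delete {B} k∉B = begin
    length (maxPositions (withoutMaximal B))      ≡⟨ cong length (maxPositions-withoutMaximal B) ⟩
    length (P ++ X B)                             ≡⟨ length-++ P ⟩
    c + length (X B)                              ≡⟨ cong (c +_) (sym (length-map suc (X B))) ⟩
    c + length (map suc (X B))                    ≡⟨ cong (_∸ 1) (sym (+-suc c _)) ⟩
    c + length (k ∷ map suc (X B)) ∸ 1            ≡⟨ cong (_∸ 1) (sym (length-++ P)) ⟩
    length (P ++ k ∷ map suc (X B)) ∸ 1           ≡⟨ cong (λ L → length L ∸ 1) (sym (maxPositions-withMaximal k∉B)) ⟩
    length (maxPositions (withMaximal B)) ∸ 1     ∎

  rep-delete : ∀ {B} → All (_< k) A → k ∉ B → rep (withoutMaximal B) ≡ rep (withMaximal B)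
  rep-delete {B} A<k k∉B = begin
    length t ∸ length (deduplicate _≟_ t)
      ≡⟨ cong (length t ∸_) (sym (length-deduplicate-map (raise-injective k) t)) ⟩
    length t ∸ length (deduplicate _≟_ (map (raise k) t))
      ≡⟨ cong (λ L → length t ∸ length (deduplicate _≟_ L)) map-raise-t ⟩
    suc (length t) ∸ suc (length (deduplicate _≟_ (A ++ B)))
      ≡⟨ sym (cong₂ _∸_ (length-withMaximal B) (length-deduplicate-insert A k∉A++B)) ⟩
    length s ∸ length (deduplicate _≟_ s) ∎
    where
    s = withMaximal B
    t = withoutMaximal B
    map-raise-t : map (raise k) t ≡ A ++ B
    map-raise-t = trans (map-++ (raise k) A _) (cong₂ _++_ (map-id-local (All.map raise-< A<k)) (map-raise-lower k∉B))
    k∉A++B : k ∉ A ++ B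
    k∉A++B k∈ with ∈-++⁻ A k∈
    ... | inj₁ k∈A = ∉-< A<k k∈A
    ... | inj₂ k∈B = k∉B k∈B

  at-withMaximal-k : ∀ B → at (withMaximal B) k ≡ just k
  at-withMaximal-k B = at-++-length A

  at-withoutMaximal-k : ∀ {B} → NextIsMaximal k B → at (withoutMaximal B) k ≡ nothing ⊎ at (withoutMaximal B) k ≡ just k
  at-withoutMaximal-k last      = inj₁ (at-++-length A)
  at-withoutMaximal-k (next B0) = inj₂ (trans (at-++-length A) (cong just (lower-suc-≥ ≤-refl)))

  pairAfter-prefix : ∀ {B} → NextIsMaximal k B → ∀ {j} → at A j ≡ just j →
    pairAfter (withMaximal B) j ≡ pairAfter (withoutMaximal B) j
  pairAfter-prefix {B} nxt {j} A[j]≡j with m≤n⇒m<n∨m≡n (at⇒< A A[j]≡j)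
  ... | inj₁ 1+j<k = begin
    pairAfter s j                       ≡⟨ pairAfter≡pairTest s j ⟩
    pairTest (at s j) (at s (suc j))    ≡⟨ cong₂ pairTest (at-++ˡ A j<k) (at-++ˡ A 1+j<k) ⟩
    pairTest (at A j) (at A (suc j))    ≡⟨ sym (cong₂ pairTest (at-++ˡ A j<k) (at-++ˡ A 1+j<k)) ⟩
    pairTest (at t j) (at t (suc j))    ≡⟨ sym (pairAfter≡pairTest t j) ⟩
    pairAfter t j                       ∎
    where
    s = withMaximal B
    t = withoutMaximal B
    j<k = <-trans (n<1+n j) 1+j<k
  ... | inj₂ 1+j≡k = trans (no-pair (withMaximal B) (at-++ˡ A j<k) (inj₂ (at-withMaximal-k B)))
                            (sym (no-pair (withoutMaximal B) (at-++ˡ A j<k) (at-withoutMaximal-k nxt)))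
    where
    j<k = subst (j <_) 1+j≡k (n<1+n j)
    no-pair : ∀ u → at u j ≡ at A j → at u k ≡ nothing ⊎ at u k ≡ just k → pairAfter u j ≡ false
    no-pair u u[j]≡ u[k] = begin
      pairAfter u j                      ≡⟨ pairAfter≡pairTest u j ⟩
      pairTest (at u j) (at u (suc j))   ≡⟨ cong₂ pairTest (trans u[j]≡ A[j]≡j) (cong (at u) 1+j≡k) ⟩
      pairTest (just j) (at u k)         ≡⟨ no-pair-k u[k] ⟩
      false                              ∎
      where
      no-pair-k : ∀ {m} → m ≡ nothing ⊎ m ≡ just k → pairTest (just j) m ≡ false
      no-pair-k (inj₁ refl) = refl
      no-pair-k (inj₂ refl) = pairTest-≢ (<⇒≢ j<k)

  pairAfter-k : ∀ {B} → NextIsMaximal k B → pairAfter (withMaximal B) k ≡ false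
  pairAfter-k {B} nxt = trans (cong (pairAfter (withMaximal B)) (sym (+-identityʳ k))) (trans (pairAfter-++ʳ A 0) (no-pair nxt))
    where
    no-pair : ∀ {B} → NextIsMaximal k B → pairAfter (k ∷ B) 0 ≡ false
    no-pair last      = refl
    no-pair (next B0) = pairTest-≢ (<⇒≢ (n<1+n k))

  pairAfter-suffix : ∀ {B} → k ∉ B → ∀ d → pairAfter (withMaximal B) (suc (k + d)) ≡ pairAfter (withoutMaximal B) (k + d)
  pairAfter-suffix {B} k∉B d = begin
    pairAfter (A ++ k ∷ B) (suc (k + d))    ≡⟨ cong (pairAfter (A ++ k ∷ B)) (sym (+-suc k d)) ⟩
    pairAfter (A ++ k ∷ B) (k + suc d)      ≡⟨ pairAfter-++ʳ A (suc d) ⟩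
    pairAfter (k ∷ B) (suc d)               ≡⟨ pairAfter-∷ k B d ⟩
    pairAfter B d                           ≡⟨ sym (pairAfter-map B lower-injective-on-B d) ⟩
    pairAfter (map (lower k) B) d           ≡⟨ sym (pairAfter-++ʳ A d) ⟩
    pairAfter (withoutMaximal B) (k + d)    ∎
    where
    lower-injective-on-B : ∀ {x y} → x ∈ B → y ∈ B → lower k x ≡ lower k y → x ≡ y
    lower-injective-on-B x∈B y∈B = lower-injective (All.lookup (∉⇒All≢ k∉B) x∈B) (All.lookup (∉⇒All≢ k∉B) y∈B)

  module _ {B : List ℕ} where
    private
      s = withMaximal B
      t = withoutMaximal B
      M = mpairGo t 0 P

    mpair-withMaximal : NextIsMaximal k B → k ∉ B → mpair s ≡ M ⊔ mpairGo t (suc c) (X B)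
    mpair-withMaximal nxt k∉B = begin
      mpairGo s 0 (maxPositions s)                   ≡⟨ cong (mpairGo s 0) (maxPositions-withMaximal k∉B) ⟩
      mpairGo s 0 (P ++ k ∷ map suc (X B))           ≡⟨ mpairGo-++ s 0 P ⟩
      mpairGo s 0 P ⊔ ((if pairAfter s k then c else 0) ⊔ mpairGo s (suc c) (map suc (X B)))
        ≡⟨ cong₂ (λ m b → m ⊔ ((if b then c else 0) ⊔ mpairGo s (suc c) (map suc (X B)))) prefix (pairAfter-k nxt) ⟩
      M ⊔ mpairGo s (suc c) (map suc (X B))          ≡⟨ cong (M ⊔_) suffix ⟩
      M ⊔ mpairGo t (suc c) (X B)                    ∎
      where
      prefix : mpairGo s 0 P ≡ M
      prefix = trans (cong (mpairGo s 0) (sym (map-id P)))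
                     (mpairGo-map (λ j → j) 0 (All.map (pairAfter-prefix nxt) (maxFrom-maximal A)))
      suffix : mpairGo s (suc c) (map suc (X B)) ≡ mpairGo t (suc c) (X B)
      suffix = mpairGo-map suc (suc c) (All.map (λ { (d , refl , _) → pairAfter-suffix k∉B d }) (maxFrom-sound k (map (lower k) B)))

    mpair-withoutMaximal : mpair t ≡ M ⊔ mpairGo t c (X B)
    mpair-withoutMaximal = trans (cong (mpairGo t 0) (maxPositions-withoutMaximal B)) (mpairGo-++ t 0 P)

    mpair-delete : NextIsMaximal k B → k ∉ B → suc (mpair s) ≡ c ⊎ suc (mpair t) ≡ c → mpair t ≡ mpair s
    -- No maximal after the (mpair + 1)-th one is paired, so X B contributes nothing to either mpair.
    mpair-delete nxt k∉B selected-at-c = begin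
      mpair t                       ≡⟨ mpair-withoutMaximal ⟩
      M ⊔ mpairGo t c (X B)         ≡⟨ cong (M ⊔_) (trans (vanishes c) (sym (vanishes (suc c)))) ⟩
      M ⊔ mpairGo t (suc c) (X B)   ≡⟨ sym (mpair-withMaximal nxt k∉B) ⟩
      mpair s                       ∎
      where
      vanishes : ∀ j → mpairGo t j (X B) ≡ 0
      vanishes = [ (λ e → mpairGo-vanishes t (suc c) (X B) (m<n⇒m<1+n (Y<c e)))
                 , (λ e → mpairGo-vanishes t c (X B) (Z<c e)) ]′ selected-at-c
        where
        Y<c : suc (mpair s) ≡ c → mpairGo t (suc c) (X B) < c
        Y<c e = subst (mpairGo t (suc c) (X B) <_) e
                      (s≤s (subst (mpairGo t (suc c) (X B) ≤_) (sym (mpair-withMaximal nxt k∉B)) (m≤n⊔m M _)))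
        Z<c : suc (mpair t) ≡ c → mpairGo t c (X B) < c
        Z<c e = subst (mpairGo t c (X B) <_) e
                      (s≤s (subst (mpairGo t c (X B) ≤_) (sym mpair-withoutMaximal) (m≤n⊔m M _)))

  X-next : ∀ B0 → X (suc k ∷ B0) ≡ k ∷ maxFrom (suc k) (map (lower k) B0)
  X-next B0 = trans (cong (λ y → maxFrom k (y ∷ map (lower k) B0)) (lower-suc-≥ ≤-refl)) (maxFrom-self k (map (lower k) B0))

  index-withMaximal : ∀ {B q} → k ∉ B → at (maxPositions (withMaximal B)) q ≡ just k → q ≡ c
  index-withMaximal {B} {q} k∉B e = index-of-∷ P (∉-< P<k) (∉-> (Allₚ.map⁺ (All.map s≤s (maxFrom-≥ k (map (lower k) B)))))
    (subst (λ L → at L q ≡ just k) (maxPositions-withMaximal k∉B) e)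

  index-withoutMaximal-next : ∀ {B0 q} → at (maxPositions (withoutMaximal (suc k ∷ B0))) q ≡ just k → q ≡ c
  index-withoutMaximal-next {B0} {q} e = index-of-∷ P (∉-< P<k) (∉-> (maxFrom-≥ (suc k) (map (lower k) B0)))
    (subst (λ L → at L q ≡ just k) (trans (maxPositions-withoutMaximal (suc k ∷ B0)) (cong (P ++_) (X-next B0))) e)

  selected-withoutMaximal : ∀ {B} → NextIsMaximal k B → suc (mpair (withoutMaximal B)) ≡ c → selected (withoutMaximal B) ≡ k
  selected-withoutMaximal {B} nxt e = trans
    (cong (fromMaybe (length (withoutMaximal B))) (begin
      at (maxPositions (withoutMaximal B)) (suc (mpair (withoutMaximal B)))   ≡⟨ cong₂ at (maxPositions-withoutMaximal B) e ⟩
      at (P ++ X B) c                                                          ≡⟨ at-++-length P ⟩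
      at (X B) 0                                                               ∎))
    (last-or-next nxt)
    where
    last-or-next : ∀ {B} → NextIsMaximal k B → fromMaybe (length (withoutMaximal B)) (at (X B) 0) ≡ k
    last-or-next last      = trans (length-++ A) (+-identityʳ k)
    last-or-next (next B0) = cong (λ L → fromMaybe (length (withoutMaximal (suc k ∷ B0))) (at L 0)) (X-next B0)

  nextIsMaximal⇔ : ∀ B → (suc k ≡ length (withMaximal B) ⊎ at (withMaximal B) (suc k) ≡ just (suc k)) ⇔ NextIsMaximal k B
  nextIsMaximal⇔ B = mk⇔ (to B) from
    where
    to : ∀ B → suc k ≡ length (withMaximal B) ⊎ at (withMaximal B) (suc k) ≡ just (suc k) → NextIsMaximal k B
    to []       _        = last
    to (b ∷ B′) (inj₁ e) =
      ⊥-elim (m+1+n≢m k (sym (suc-injective (trans e (trans (length-withMaximal (b ∷ B′)) (cong suc (length-++ A)))))))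
    to (b ∷ B′) (inj₂ e) with just-injective (trans (sym (at-++-∷-suc A)) e)
    ... | refl = next B′
    from : ∀ {B} → NextIsMaximal k B → suc k ≡ length (withMaximal B) ⊎ at (withMaximal B) (suc k) ≡ just (suc k)
    from last      = inj₁ (sym (trans (length-withMaximal []) (cong suc (trans (length-++ A) (+-identityʳ k)))))
    from (next B0) = inj₂ (at-++-∷-suc A)

  mpair-insert : ∀ {B} → NextIsMaximal k B → k ∉ B → suc (mpair (withoutMaximal B)) ≡ c → suc (mpair (withMaximal B)) ≡ c
  mpair-insert nxt k∉B e = trans (cong suc (sym (mpair-delete nxt k∉B (inj₂ e)))) e

  inF-insert : ∀ {B} → NextIsMaximal k B → k ∉ B → suc (mpair (withoutMaximal B)) ≡ c → InF (withMaximal B)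
  inF-insert {B} nxt k∉B e = selected<maxStat , k , selected≡k , Equivalence.from (nextIsMaximal⇔ B) nxt
    where
    s = withMaximal B
    1+mpair≡c = mpair-insert nxt k∉B e
    selected≡k : at (maxPositions s) (suc (mpair s)) ≡ just k
    selected≡k = trans (cong₂ at (maxPositions-withMaximal k∉B) 1+mpair≡c) (at-++-length P)
    selected<maxStat : suc (mpair s) < maxStat s
    selected<maxStat = subst₂ _<_ (sym 1+mpair≡c) (sym (trans (cong length (maxPositions-withMaximal k∉B)) (length-++ P)))
                              (m<m+n c (s≤s z≤n))

  index-withoutMaximal-last : 0 < c → at (maxPositions (withoutMaximal [])) (suc (mpair (withoutMaximal []))) ≡ nothing →
    suc (mpair (withoutMaximal [])) ≡ c
  index-withoutMaximal-last 0<c e = ≤-antisym (mpairGo-< t 0 (maxPositions t) 0<c (≤-reflexive maxStat≡c))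
                                              (subst (_≤ suc (mpair t)) maxStat≡c (at-nothing⇒≤ (maxPositions t) e))
    where
    t = withoutMaximal []
    maxStat≡c : length (maxPositions t) ≡ c
    maxStat≡c = trans (cong length (maxPositions-withoutMaximal [])) (cong length (++-identityʳ P))

  deleteSelected-withMaximal : ∀ {B} → k ∉ B → suc (mpair (withMaximal B)) ≡ c →
    deleteSelected (withMaximal B) ≡ withoutMaximal B
  deleteSelected-withMaximal {B} k∉B e =
    trans (cong (λ j → deleteMaximal j (withMaximal B)) selected≡k) (deleteMaximal-withMaximal B)
    where
    selected≡k : selected (withMaximal B) ≡ k
    selected≡k = cong (fromMaybe (length (withMaximal B))) (trans (cong₂ at (maxPositions-withMaximal k∉B) e) (at-++-length P))

  insertSelected-withoutMaximal : ∀ {B} → NextIsMaximal k B → k ∉ B → suc (mpair (withoutMaximal B)) ≡ c →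
    insertSelected (withoutMaximal B) ≡ withMaximal B
  insertSelected-withoutMaximal {B} nxt k∉B e =
    trans (cong (λ j → insertMaximal j (withoutMaximal B)) (selected-withoutMaximal nxt e)) (insertMaximal-withoutMaximal k∉B)

  deletion : ∀ {n B} → InT n (withMaximal B) → NextIsMaximal k B → suc (mpair (withMaximal B)) ≡ c →
    IsDeletion n (withMaximal B) (deleteSelected (withMaximal B))
  deletion {n} {B} (len , s-inv , s-av) nxt 1+mpair≡c =
    subst (IsDeletion n (withMaximal B)) (sym (deleteSelected-withMaximal k∉B 1+mpair≡c)) (record
      { inT      = cong (_∸ 1) (trans (sym (length-withMaximal B)) len) , invSeq-delete s-inv , avoids-delete A<k k∉B s-av
      ; maxStat≡ = maxStat-delete k∉B
      ; rep≡     = rep-delete A<k k∉B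
      ; mpair≡   = mpair≡
      ; inverse  = insertSelected-withoutMaximal nxt k∉B (trans (cong suc mpair≡) 1+mpair≡c)
      })
    where
    k∉B = avoids⇒∉ nxt s-av
    A<k = invSeq-prefix-< A s-inv
    mpair≡ = mpair-delete nxt k∉B (inj₁ 1+mpair≡c)

  insertion : ∀ {n B} → 1 ≤ n → InT (n ∸ 1) (withoutMaximal B) → NextIsMaximal k B → k ∉ B →
    suc (mpair (withoutMaximal B)) ≡ c →
    (InT n (withMaximal B) × InF (withMaximal B)) × deleteSelected (withMaximal B) ≡ withoutMaximal B
  insertion {n} {B} 1≤n (len , t-inv , t-av) nxt k∉B 1+mpair≡c =
    ( (trans (length-withMaximal B) (trans (cong suc len) (m+[n∸m]≡n 1≤n)) , invSeq-insert t-inv , avoids-insert A<k k∉B nxt t-av)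
    , s∈F )
    , deleteSelected-withMaximal k∉B (mpair-insert nxt k∉B 1+mpair≡c)
    where
    A<k = invSeq-prefix-< A t-inv
    s∈F = inF-insert nxt k∉B 1+mpair≡c

deleteSelected-isDeletion : ∀ {n s} → InT n s → InF s → IsDeletion n s (deleteSelected s)
deleteSelected-isDeletion {s = s} s∈T@(_ , _ , s-av) (_ , k , selected≡k , follows)
  with at-split s (maxPositions-maximal s selected≡k)
... | A , B , refl , refl = deletion s∈T nxt (index-withMaximal (avoids⇒∉ nxt s-av) selected≡k)
  where
  open Prefix A
  nxt = Equivalence.to (nextIsMaximal⇔ B) follows

maxPositions-nonempty : ∀ s → IsInvSeq s → 0 < length s → 0 < length (maxFrom 0 s)
maxPositions-nonempty (x ∷ xs) s-inv _ with n≤0⇒n≡0 (s-inv 0 x refl)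
... | refl = subst (0 <_) (sym (cong length (maxFrom-self 0 xs))) (s≤s z≤n)

SelectedIs : List ℕ → Maybe ℕ → Set
SelectedIs t m = at (maxPositions t) (suc (mpair t)) ≡ m

insert-next : ∀ {m} A D → let k = length A in InT (suc m) (A ++ k ∷ D) → SelectedIs (A ++ k ∷ D) (just k) →
  ∃ λ s → (InT (suc (suc m)) s × InF s) × deleteSelected s ≡ A ++ k ∷ D
insert-next {m} A D t∈T selected≡k = withMaximal B , proj₁ inserted , trans (proj₂ inserted) t′≡t
  where
  open Prefix A
  B = suc k ∷ map (raise k) D
  t′≡t : withoutMaximal B ≡ A ++ k ∷ D
  t′≡t = cong₂ (λ y ys → A ++ y ∷ ys) (lower-suc-≥ ≤-refl) (map-lower-raise k D)
  k∉B : k ∉ B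
  k∉B (here k≡1+k) = 1+n≢n (sym k≡1+k)
  k∉B (there k∈) with ∈-map⁻ (raise k) k∈
  ... | y , _ , k≡raise = raise-≢ k y (sym k≡raise)
  inserted = insertion (s≤s z≤n) (subst (InT (suc m)) (sym t′≡t) t∈T) (next _) k∉B
                       (index-withoutMaximal-next (subst (λ u → SelectedIs u (just k)) (sym t′≡t) selected≡k))

insert-last : ∀ {m t} → InT (suc m) t → SelectedIs t nothing →
  ∃ λ s → (InT (suc (suc m)) s × InF s) × deleteSelected s ≡ t
insert-last {m} {t} t∈T@(len , t-inv , _) selected≡nothing = withMaximal [] , proj₁ inserted , trans (proj₂ inserted) t′≡t
  where
  open Prefix t
  t′≡t : withoutMaximal [] ≡ t
  t′≡t = ++-identityʳ t
  0<c : 0 < c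
  0<c = maxPositions-nonempty t t-inv (subst (0 <_) (sym len) (s≤s z≤n))
  inserted = insertion (s≤s z≤n) (subst (InT (suc m)) (sym t′≡t) t∈T) last (λ ())
                       (index-withoutMaximal-last 0<c (subst (λ u → SelectedIs u nothing) (sym t′≡t) selected≡nothing))

deleteSelected-surjective : ∀ {n} → 2 ≤ n → ∀ {t} → InT (n ∸ 1) t →
  ∃ λ s → (InT n s × InF s) × deleteSelected s ≡ t
deleteSelected-surjective {suc (suc m)} (s≤s (s≤s _)) {t} t∈T with at (maxPositions t) (suc (mpair t)) in selected≡
... | nothing = insert-last t∈T selected≡
... | just k with at-split t (maxPositions-maximal t selected≡)
...   | A , D , refl , refl = insert-next A D t∈T selected≡

lemma4p6 : ∀ n → 2 ≤ n →
    Σ (TF n → T (n ∸ 1)) λ ψ →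
      (∀ (a b : TF n) → proj₁ (ψ a) ≡ proj₁ (ψ b) → proj₁ a ≡ proj₁ b)
      × (∀ (t : T (n ∸ 1)) → Σ (TF n) λ a → proj₁ (ψ a) ≡ proj₁ t)
      × (∀ (a : TF n) → maxStat (proj₁ (ψ a)) ≡ maxStat (proj₁ a) ∸ 1
             × rep (proj₁ (ψ a)) ≡ rep (proj₁ a)
             × mpair (proj₁ (ψ a)) ≡ mpair (proj₁ a))
lemma4p6 n 2≤n = ψ , ψ-injective , ψ-surjective , ψ-statistics
  where
  deletion-of : (a : TF n) → IsDeletion n (proj₁ a) (deleteSelected (proj₁ a))
  deletion-of (s , s∈T , s∈F) = deleteSelected-isDeletion s∈T s∈F

  ψ : TF n → T (n ∸ 1)
  ψ a = deleteSelected (proj₁ a) , IsDeletion.inT (deletion-of a)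

  ψ-injective : ∀ (a b : TF n) → proj₁ (ψ a) ≡ proj₁ (ψ b) → proj₁ a ≡ proj₁ b
  ψ-injective a b ψa≡ψb = begin
    proj₁ a                                    ≡⟨ sym (IsDeletion.inverse (deletion-of a)) ⟩
    insertSelected (deleteSelected (proj₁ a))  ≡⟨ cong insertSelected ψa≡ψb ⟩
    insertSelected (deleteSelected (proj₁ b))  ≡⟨ IsDeletion.inverse (deletion-of b) ⟩
    proj₁ b                                    ∎

  ψ-surjective : ∀ (t : T (n ∸ 1)) → Σ (TF n) λ a → proj₁ (ψ a) ≡ proj₁ t
  ψ-surjective (t , t∈T) with deleteSelected-surjective 2≤n t∈T
  ... | s , s∈TF , deleted = (s , s∈TF) , deleted

  ψ-statistics : ∀ (a : TF n) → maxStat (proj₁ (ψ a)) ≡ maxStat (proj₁ a) ∸ 1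
                   × rep (proj₁ (ψ a)) ≡ rep (proj₁ a) × mpair (proj₁ (ψ a)) ≡ mpair (proj₁ a)
  ψ-statistics a = maxStat≡ , rep≡ , mpair≡
    where open IsDeletion (deletion-of a)
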